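{- Let $W$ be a set of eight distinct MacMahon cubes such that $G_W$ has eight edges. If $G_W$ is connected, then the solution number of $W$ for the target $\mathrm{Ba}$ is $2$.
   Context: A MacMahon cube is a cube whose six faces are painted with the colors $1,\dots,6$, each used once, up to rotation (there are $30$ of them). At each vertex three faces meet; reading their colors clockwise as seen from outside gives a cyclic triple, and the corner number of the vertex is the cyclic rotation of this triple of smallest three-digit value; each MacMahon cube has $8$ distinct corner numbers. $\mathrm{Ba}$ denotes the MacMahon cube whose corner numbers are $\{123,134,146,162,253,265,354,456\}$. Every MacMahon cube other than $\mathrm{Ba}$ shares either $0$ or exactly $2$ corner numbers with $\mathrm{Ba}$. $M$ is the multigraph whose vertex set is the $8$ corner numbers of $\mathrm{Ba}$, with one edge, labeled $C$, joining the two shared corner numbers for each MacMahon cube $C\neq\mathrm{Ba}$ sharing exactly two corner numbers with $\mathrm{Ba}$ ($20$ edges, no loops, some parallel pairs). For a set $W$ of MacMahon cubes, $G_W$ is the subgraph of $M$ with all $8$ vertices and exactly the edges labeled by cubes in $W$. A solution for target $\mathrm{Ba}$ is a bijection $\sigma$ from $W$ to the corner numbers of $\mathrm{Ba}$ with $\sigma(C)$ a corner number of $C$ for all $C\in W$; the solution number is the number of such bijections. -}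

module Defs where

open import Data.Nat using (ℕ; zero; suc; _+_; _*_; _<ᵇ_; _≡ᵇ_)
open import Data.Bool using (Bool; true; false; if_then_else_; _∧_)
open import Data.Fin using (Fin; toℕ; #_)
import Data.Fin as Fin
open import Data.List using (List; []; _∷_; map; allFin)
open import Data.Nat.ListAction using (sum)
open import Data.Bool.ListAction using (any)
open import Data.Product using (Σ; ∃; _×_; _,_)
open import Data.Empty using (⊥)
open import Relation.Nullary using (¬_)
open import Relation.Binary.PropositionalEquality using (_≡_; _≢_)
open import Relation.Binary.Construct.Closure.ReflexiveTransitive using (Star)
open import Function.Definitions using (Injective)
open import Data.Fin.Permutation using (Permutation′; _⟨$⟩ʳ_)

-- Geometry of the cube.
-- Faces (Fin 6): 0 = +x, 1 = -x, 2 = +y, 3 = -y, 4 = +z, 5 = -z.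
-- Colours (Fin 6): the colour k : Fin 6 stands for the colour toℕ k + 1,
-- i.e. the colours 1,…,6.

Face : Set
Face = Fin 6

Colour : Set
Colour = Fin 6

record Painting : Set where
  constructor painting
  field
    paint    : Face → Colour
    paint-inj : Injective _≡_ _≡_ paint
open Painting public

-- The eight vertices, with the three faces meeting there listed in
-- clockwise order as seen from outside the cube.
-- Vertex (sx,sy,sz): if the number of minus signs is even the faces
-- (±x,±y,±z) appear counterclockwise, so clockwise is (x,z,y);
-- otherwise clockwise is (x,y,z).
vertexFaces : Fin 8 → Face × Face × Face
vertexFaces Fin.zero = (# 0 , # 4 , # 2)
vertexFaces (Fin.suc Fin.zero) = (# 0 , # 2 , # 5)
vertexFaces (Fin.suc (Fin.suc Fin.zero)) = (# 0 , # 3 , # 4)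
vertexFaces (Fin.suc (Fin.suc (Fin.suc Fin.zero))) = (# 0 , # 5 , # 3)
vertexFaces (Fin.suc (Fin.suc (Fin.suc (Fin.suc Fin.zero)))) = (# 1 , # 2 , # 4)
vertexFaces (Fin.suc (Fin.suc (Fin.suc (Fin.suc (Fin.suc Fin.zero))))) = (# 1 , # 5 , # 2)
vertexFaces (Fin.suc (Fin.suc (Fin.suc (Fin.suc (Fin.suc (Fin.suc Fin.zero)))))) = (# 1 , # 4 , # 3)
vertexFaces (Fin.suc (Fin.suc (Fin.suc (Fin.suc (Fin.suc (Fin.suc (Fin.suc Fin.zero))))))) = (# 1 , # 3 , # 5)

digits : ℕ → ℕ → ℕ → ℕ
digits a b c = 100 * a + 10 * b + c

cyclicMin : ℕ → ℕ → ℕ → ℕ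
cyclicMin a b c =
  let x = digits a b c ; y = digits b c a ; z = digits c a b in
  if x <ᵇ y then (if x <ᵇ z then x else z) else (if y <ᵇ z then y else z)

colourNum : Colour → ℕ
colourNum k = suc (toℕ k)

corner : Painting → Fin 8 → ℕ
corner p v with vertexFaces v
... | (f , g , h) = cyclicMin (colourNum (paint p f)) (colourNum (paint p g)) (colourNum (paint p h))

IsCorner : Painting → ℕ → Set
IsCorner p n = ∃ λ v → corner p v ≡ n

isCornerᵇ : Painting → ℕ → Bool
isCornerᵇ p n = any (λ v → corner p v ≡ᵇ n) (allFin 8)

-- Rotations. The rotation group of the cube is generated by the
-- quarter turns about the z-axis and about the x-axis.

data Gen : Set where
  rz rx : Gen

genAct : Gen → Face → Face
genAct rz Fin.zero = # 2
genAct rz (Fin.suc Fin.zero) = # 3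
genAct rz (Fin.suc (Fin.suc Fin.zero)) = # 1
genAct rz (Fin.suc (Fin.suc (Fin.suc Fin.zero))) = # 0
genAct rz (Fin.suc (Fin.suc (Fin.suc (Fin.suc Fin.zero)))) = # 4
genAct rz (Fin.suc (Fin.suc (Fin.suc (Fin.suc (Fin.suc Fin.zero))))) = # 5
genAct rx Fin.zero = # 0
genAct rx (Fin.suc Fin.zero) = # 1
genAct rx (Fin.suc (Fin.suc Fin.zero)) = # 4
genAct rx (Fin.suc (Fin.suc (Fin.suc Fin.zero))) = # 5
genAct rx (Fin.suc (Fin.suc (Fin.suc (Fin.suc Fin.zero)))) = # 3
genAct rx (Fin.suc (Fin.suc (Fin.suc (Fin.suc (Fin.suc Fin.zero))))) = # 2

Rotation : Set
Rotation = List Gen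

rotAct : Rotation → Face → Face
rotAct [] f = f
rotAct (g ∷ w) f = genAct g (rotAct w f)

SameCube : Painting → Painting → Set
SameCube p q = ∃ λ (w : Rotation) → ∀ f → paint q f ≡ paint p (rotAct w f)

baCorner : Fin 8 → ℕ
baCorner Fin.zero = 123
baCorner (Fin.suc Fin.zero) = 134
baCorner (Fin.suc (Fin.suc Fin.zero)) = 146
baCorner (Fin.suc (Fin.suc (Fin.suc Fin.zero))) = 162
baCorner (Fin.suc (Fin.suc (Fin.suc (Fin.suc Fin.zero)))) = 253
baCorner (Fin.suc (Fin.suc (Fin.suc (Fin.suc (Fin.suc Fin.zero))))) = 265
baCorner (Fin.suc (Fin.suc (Fin.suc (Fin.suc (Fin.suc (Fin.suc Fin.zero)))))) = 354
baCorner (Fin.suc (Fin.suc (Fin.suc (Fin.suc (Fin.suc (Fin.suc (Fin.suc Fin.zero))))))) = 456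

sharedCount : Painting → ℕ
sharedCount p = sum (map (λ j → if isCornerᵇ p (baCorner j) then 1 else 0) (allFin 8))

-- p labels an edge of M: it shares exactly two corner numbers with Ba
-- (this excludes Ba itself, which shares all eight).
IsEdgeOfM : Painting → Set
IsEdgeOfM p = sharedCount p ≡ 2

Family : Set
Family = Fin 8 → Painting

Distinct : Family → Set
Distinct W = ∀ i j → i ≢ j → ¬ SameCube (W i) (W j)

numEdges : Family → ℕ
numEdges W = sum (map (λ i → if sharedCount (W i) ≡ᵇ 2 then 1 else 0) (allFin 8))

-- Adjacency in G_W (vertices = Ba's corner numbers, indexed by Fin 8):
-- some cube of W labels an edge of M joining baCorner j and baCorner k.
Adj : Family → Fin 8 → Fin 8 → Set
Adj W j k = ∃ λ i → IsEdgeOfM (W i) × j ≢ k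
                    × IsCorner (W i) (baCorner j) × IsCorner (W i) (baCorner k)

Connected : Family → Set
Connected W = ∀ j k → Star (Adj W) j k

IsSolution : Family → Permutation′ 8 → Set
IsSolution W σ = ∀ i → IsCorner (W i) (baCorner (σ ⟨$⟩ʳ i))

SolutionNumberIsTwo : Family → Set
SolutionNumberIsTwo W =
  Σ (Permutation′ 8) λ σ → Σ (Permutation′ 8) λ τ →
    IsSolution W σ × IsSolution W τ × (∃ λ i → σ ⟨$⟩ʳ i ≢ τ ⟨$⟩ʳ i)
    × (∀ π → IsSolution W π →
         (∀ i → π ⟨$⟩ʳ i ≡ σ ⟨$⟩ʳ i) ⊎′ (∀ i → π ⟨$⟩ʳ i ≡ τ ⟨$⟩ʳ i))
  where open import Data.Sum using () renaming (_⊎_ to _⊎′_)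

-- G_W has eight vertices, eight edges and is connected, so it is a spanning tree plus one
-- edge and contains exactly one cycle.  A solution σ orients every edge C towards the
-- endpoint σ C so that each vertex receives exactly one edge.
--
-- Existence: a spanning tree uses only seven edges, so deleting an unused edge e* = {x, y}
-- leaves G_W connected.  Orienting a spanning tree of G_W − e* away from x, and e* towards
-- x, is a solution; doing the same with y gives a second one, differing from it on e*.
--
-- Uniqueness: fix a solution σ and let parent v be the tail of the edge entering v.  If a
-- solution π disagrees with σ on e, then π e is the tail of e, and e lies on a cycle of the
-- permutation σ⁻¹π; so σ e lies on a cycle of parent.  By connectivity every vertex reaches
-- that cycle under parent.  For another solution ρ ≠ σ, the set of vertices v with
-- ρ (σ⁻¹ v) ≠ v is nonempty and closed under parent, so it contains the cycle: ρ disagrees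
-- with σ wherever π does.  Applying this to ρ and the second solution τ in both orders
-- forces ρ = τ.

module Submission where

open import Defs
open import Data.Nat using (ℕ; zero; suc; _+_; _≤_; _<_; z≤n; s≤s; _≡ᵇ_)
import Data.Nat.Properties as ℕ
open import Data.Bool using (Bool; true; false; T; if_then_else_)
open import Data.Fin as Fin using (Fin; toℕ; punchIn; punchOut)
open import Data.Fin.Properties
  using (_≟_; any?; all?; ¬∀⟶∃¬; pigeonhole; injective⇒≤; suc-injective;
         punchOut-injective; punchIn-injective; punchInᵢ≢i; punchIn-punchOut)
open import Data.Fin.Permutation
  using (Permutation′; _⟨$⟩ʳ_; _⟨$⟩ˡ_; _≈_; permutation; flip; inverseˡ; inverseʳ)
open import Data.List as List using (allFin)
open import Data.List.Properties using (map-tabulate)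
open import Data.Nat.ListAction using (sum)
open import Data.List.Relation.Unary.Any using (satisfied)
open import Data.List.Relation.Unary.Any.Properties using (any⁺; any⁻)
open import Data.List.Membership.Propositional using (lose)
open import Data.List.Membership.Propositional.Properties using (∈-allFin)
open import Data.Vec as Vec using (Vec; []; _∷_; lookup)
open import Data.Vec.Relation.Unary.All using (All; []; _∷_)
open import Data.Vec.Relation.Unary.Any using (here; there)
open import Data.Vec.Relation.Unary.Any.Properties using (lookup-index)
open import Data.Vec.Membership.Propositional using (_∈_; _∉_)
open import Data.Vec.Membership.Propositional.Properties using (∈-map⁺)
open import Data.Vec.Relation.Unary.Unique.Propositional using (Unique; []; _∷_)
open import Data.Vec.Relation.Unary.Unique.Propositional.Properties using (lookup-injective)
open import Data.Product using (Σ; ∃; ∃₂; _×_; _,_; proj₁; proj₂; map₂)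
open import Data.Sum as Sum using (_⊎_; inj₁; inj₂)
open import Function using (_∘_; id; Injective; _⇔_; mk⇔; Equivalence)
open import Relation.Nullary using (¬_; Dec; yes; no; contradiction)
open import Relation.Binary.PropositionalEquality
open import Relation.Binary.Construct.Closure.ReflexiveTransitive
  using (Star; ε; _◅_; _◅◅_; fold; reverse) renaming (map to map-Star)

private variable
  A : Set
  k m n : ℕ

module _ {A : Set} where
  open import Function.Endo.Propositional A using (_^_)

  ^-commutes : ∀ (f : A → A) k x → (f ^ k) (f x) ≡ f ((f ^ k) x)
  ^-commutes f zero    x = refl
  ^-commutes f (suc k) x = cong f (^-commutes f k x)

module _ {n : ℕ} where
  open import Function.Endo.Propositional (Fin n) using (_^_)

  injective⇒periodic : ∀ {f : Fin n → Fin n} → Injective _≡_ _≡_ f →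
                       ∀ x → ∃ λ p → (f ^ suc p) x ≡ x
  injective⇒periodic {f} f-inj x
    with i , j , i<j , fⁱx≡fʲx ← pigeonhole ℕ.≤-refl (λ (i : Fin (suc n)) → (f ^ toℕ i) x)
    = cancel (toℕ i) (toℕ j) i<j fⁱx≡fʲx
    where
    cancel : ∀ i j → i < j → (f ^ i) x ≡ (f ^ j) x → ∃ λ p → (f ^ suc p) x ≡ x
    cancel zero    (suc p) _         eq = p , sym eq
    cancel (suc i) (suc j) (s≤s i<j) eq = cancel i j i<j (f-inj eq)

injective⇒surjective : ∀ {f : Fin n → Fin n} → Injective _≡_ _≡_ f → ∀ y → ∃ λ x → f x ≡ y
injective⇒surjective {zero}      _     ()
injective⇒surjective {suc n} {f} f-inj y with any? (λ x → f x ≟ y)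
... | yes hit = hit
... | no miss = contradiction (injective⇒≤ squeezed-inj) ℕ.1+n≰n
  where
  squeezed : Fin (suc n) → Fin n
  squeezed x = punchOut {i = y} {j = f x} (λ y≡fx → miss (x , sym y≡fx))
  squeezed-inj : Injective _≡_ _≡_ squeezed
  squeezed-inj = f-inj ∘ punchOut-injective {i = y} _ _

injective⇒permutation : ∀ {f : Fin n → Fin n} → Injective _≡_ _≡_ f →
                        ∃ λ (π : Permutation′ n) → ∀ x → π ⟨$⟩ʳ x ≡ f x
injective⇒permutation {f = f} f-inj =
  permutation f f⁻¹ (proj₂ ∘ surjective) (λ x → f-inj (proj₂ (surjective (f x)))) , λ _ → refl
  where
  surjective = injective⇒surjective f-inj
  f⁻¹ = proj₁ ∘ surjective

⟨$⟩ʳ-injective : ∀ (π : Permutation′ n) → Injective _≡_ _≡_ (π ⟨$⟩ʳ_)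
⟨$⟩ʳ-injective π {x} {y} eq = begin
  x                     ≡⟨ inverseˡ π ⟨
  π ⟨$⟩ˡ (π ⟨$⟩ʳ x)    ≡⟨ cong (π ⟨$⟩ˡ_) eq ⟩
  π ⟨$⟩ˡ (π ⟨$⟩ʳ y)    ≡⟨ inverseˡ π ⟩
  y                     ∎
  where open ≡-Reasoning

covering⇒≤ : ∀ (xs : Vec (Fin m) k) → (∀ x → x ∈ xs) → m ≤ k
covering⇒≤ xs covers = injective⇒≤ λ {x} {y} eq →
  trans (lookup-index (covers x)) (trans (cong (lookup xs) eq) (sym (lookup-index (covers y))))

unique⇒≤ : ∀ {xs : Vec (Fin n) k} → Unique xs → k ≤ n
unique⇒≤ xs-unique = injective⇒≤ (lookup-injective xs-unique _ _)

∉⇒All≢ : ∀ {x : A} {xs : Vec A k} → x ∉ xs → All (x ≢_) xs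
∉⇒All≢ {xs = []}     _   = []
∉⇒All≢ {xs = y ∷ xs} x∉ = x∉ ∘ here ∷ ∉⇒All≢ (x∉ ∘ there)

module Multigraph {n m : ℕ} (a b : Fin m → Fin n) where

  private variable
    e : Fin m
    x y z : Fin n

  Joins : Fin m → Fin n → Fin n → Set
  Joins e x y = (x ≡ a e × y ≡ b e) ⊎ (x ≡ b e × y ≡ a e)

  Incident : Fin n → Fin m → Set
  Incident x e = x ≡ a e ⊎ x ≡ b e

  Adjacent : Fin n → Fin n → Set
  Adjacent x y = ∃ λ e → Joins e x y

  IsConnected : Set
  IsConnected = ∀ x y → Star Adjacent x y

  joins-sym : Joins e x y → Joins e y x
  joins-sym (inj₁ (x≡a , y≡b)) = inj₂ (y≡b , x≡a)
  joins-sym (inj₂ (x≡b , y≡a)) = inj₁ (y≡a , x≡b)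

  joins⇒incident : Joins e x y → Incident x e
  joins⇒incident (inj₁ (x≡a , _)) = inj₁ x≡a
  joins⇒incident (inj₂ (x≡b , _)) = inj₂ x≡b

  incident⇒joins : Incident x e → Incident y e → x ≢ y → Joins e x y
  incident⇒joins (inj₁ refl) (inj₁ refl) x≢y = contradiction refl x≢y
  incident⇒joins (inj₁ refl) (inj₂ refl) _   = inj₁ (refl , refl)
  incident⇒joins (inj₂ refl) (inj₁ refl) _   = inj₂ (refl , refl)
  incident⇒joins (inj₂ refl) (inj₂ refl) x≢y = contradiction refl x≢y

  incident-joins : Joins e x y → Incident z e → z ≡ x ⊎ z ≡ y
  incident-joins (inj₁ (refl , refl)) (inj₁ refl) = inj₁ refl
  incident-joins (inj₁ (refl , refl)) (inj₂ refl) = inj₂ refl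
  incident-joins (inj₂ (refl , refl)) (inj₁ refl) = inj₂ refl
  incident-joins (inj₂ (refl , refl)) (inj₂ refl) = inj₁ refl

  Star-preserves : ∀ {P : Fin n → Set} → (∀ {x y} → Adjacent x y → P x → P y) →
                   Star Adjacent x y → P x → P y
  Star-preserves {P = P} step = fold (λ x y → P x → P y) (λ xy yz → yz ∘ step xy) id

  -- A tree rooted at r is a vector of branches (u , e), each attaching a new vertex u by
  -- the edge e to an earlier one; vertices lists them, with r last.
  module Spanning (r : Fin n) where

    open import Data.Vec.Membership.DecPropositional (_≟_ {n}) using (_∈?_)

    Branch : Set
    Branch = Fin n × Fin m

    vertices : Vec Branch k → Vec (Fin n) (suc k)
    vertices []            = r ∷ []
    vertices ((u , _) ∷ t) = u ∷ vertices t

    edges : Vec Branch k → Vec (Fin m) k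
    edges = Vec.map proj₂

    data Tree : Vec Branch k → Set where
      root  : Tree []
      graft : ∀ {k u w e} {t : Vec Branch k} →
              Tree t → u ∉ vertices t → w ∈ vertices t → Joins e u w → Tree ((u , e) ∷ t)

    private variable
      t : Vec Branch k

    root∈vertices : ∀ (t : Vec Branch k) → r ∈ vertices t
    root∈vertices []      = here refl
    root∈vertices (_ ∷ t) = there (root∈vertices t)

    vertices-unique : Tree t → Unique (vertices t)
    vertices-unique root               = [] ∷ []
    vertices-unique (graft T u∉ _ _) = ∉⇒All≢ u∉ ∷ vertices-unique T

    tree-size : Tree {k} t → suc k ≤ n
    tree-size = unique⇒≤ ∘ vertices-unique

    endpoints∈vertices : Tree t → e ∈ edges t → Incident x e → x ∈ vertices t
    endpoints∈vertices (graft _ _ w∈ u-e-w) (here refl) x-e with incident-joins u-e-w x-e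
    ... | inj₁ refl = here refl
    ... | inj₂ refl = there w∈
    endpoints∈vertices (graft T _ _ _) (there e∈) x-e = there (endpoints∈vertices T e∈ x-e)

    branch-incident : Tree t → (x , e) ∈ t → Incident x e
    branch-incident (graft _ _ _ x-e-w) (here refl) = joins⇒incident x-e-w
    branch-incident (graft T _ _ _)     (there x∈)  = branch-incident T x∈

    branch-injective : Tree t → (x , e) ∈ t → (y , e) ∈ t → x ≡ y
    branch-injective (graft _ _ _ _) (here refl) (here refl) = refl
    branch-injective (graft T x∉ _ x-e-w) (here refl) (there y∈) =
      contradiction (endpoints∈vertices T (∈-map⁺ proj₂ y∈) (joins⇒incident x-e-w)) x∉
    branch-injective (graft T y∉ _ y-e-w) (there x∈) (here refl) =
      contradiction (endpoints∈vertices T (∈-map⁺ proj₂ x∈) (joins⇒incident y-e-w)) y∉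
    branch-injective (graft T _ _ _) (there x∈) (there y∈) = branch-injective T x∈ y∈

    branch-of : x ∈ vertices t → x ≢ r → ∃ λ e → (x , e) ∈ t
    branch-of {t = []}    (here refl) x≢r = contradiction refl x≢r
    branch-of {t = _ ∷ _} (here refl) _   = _ , here refl
    branch-of {t = _ ∷ _} (there x∈)  x≢r = map₂ there (branch-of x∈ x≢r)

    tree-preserves : ∀ {P : Fin n → Set} → Tree t →
                     (∀ {e x y} → e ∈ edges t → Joins e x y → P x → P y) →
                     P r → x ∈ vertices t → P x
    tree-preserves root                   _    Pr (here refl) = Pr
    tree-preserves (graft T _ w∈ x-e-w) step Pr (here refl) =
      step (here refl) (joins-sym x-e-w) (tree-preserves T (step ∘ there) Pr w∈)
    tree-preserves (graft T _ _ _)        step Pr (there x∈)  = tree-preserves T (step ∘ there) Pr x∈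

    Crossing : Vec Branch k → Fin m → Set
    Crossing t e = ∃₂ λ u w → u ∉ vertices t × w ∈ vertices t × Joins e u w

    crossing? : ∀ (t : Vec Branch k) e → Dec (Crossing t e)
    crossing? t e with a e ∈? vertices t | b e ∈? vertices t
    ... | yes a∈ | no b∉  = yes (b e , a e , b∉ , a∈ , inj₂ (refl , refl))
    ... | no a∉  | yes b∈ = yes (a e , b e , a∉ , b∈ , inj₁ (refl , refl))
    ... | yes a∈ | yes b∈ = no λ { (_ , _ , u∉ , _ , inj₁ (refl , _)) → u∉ a∈
                                 ; (_ , _ , u∉ , _ , inj₂ (refl , _)) → u∉ b∈ }
    ... | no a∉  | no b∉  = no λ { (_ , _ , _ , w∈ , inj₁ (_ , refl)) → b∉ w∈
                                 ; (_ , _ , _ , w∈ , inj₂ (_ , refl)) → a∉ w∈ }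

    SpanningTree : Set
    SpanningTree = ∃₂ λ k (t : Vec Branch k) → Tree t × (∀ x → x ∈ vertices t)

    module _ (connected : IsConnected) where

      uncrossed⇒spanning : (∀ e → ¬ Crossing t e) → ∀ x → x ∈ vertices t
      uncrossed⇒spanning {t = t} uncrossed x = Star-preserves closed (connected r x) (root∈vertices t)
        where
        closed : Adjacent y z → y ∈ vertices t → z ∈ vertices t
        closed {z = z} (e , y-e-z) y∈ with z ∈? vertices t
        ... | yes z∈ = z∈
        ... | no  z∉ = contradiction (_ , _ , z∉ , y∈ , joins-sym y-e-z) (uncrossed e)

      -- room is fuel; it cannot run out because a tree has at most n vertices.
      grow : ∀ room → Tree {k} t → n ≤ room + suc k → SpanningTree
      grow {k = k} {t = t} room T bound with any? (crossing? t)
      ... | no uncrossed = _ , _ , T , uncrossed⇒spanning λ e crossing → uncrossed (e , crossing)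
      ... | yes (_ , _ , _ , u∉ , w∈ , u-e-w) with graft T u∉ w∈ u-e-w | room
      ...   | T′ | zero     = contradiction (ℕ.≤-trans (tree-size T′) bound) (ℕ.n≮n (suc k))
      ...   | T′ | suc room = grow room T′ (subst (n ≤_) (sym (ℕ.+-suc room (suc k))) bound)

      spanning-tree : SpanningTree
      spanning-tree = grow n root (ℕ.m≤m+n n 1)

module Solutions {n : ℕ} (a b : Fin n → Fin n) where

  open Multigraph a b
  open import Function.Endo.Propositional (Fin n) using (_^_)

  private variable
    e e₀ e₁ : Fin n
    x y z : Fin n

  Solution : Permutation′ n → Set
  Solution σ = ∀ e → Incident (σ ⟨$⟩ʳ e) e

  injective-choice⇒solution : ∀ {τ : Fin n → Fin n} → Injective _≡_ _≡_ τ →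
                              (∀ x → Incident x (τ x)) → ∃ λ σ → Solution σ × ∀ x → σ ⟨$⟩ʳ τ x ≡ x
  injective-choice⇒solution {τ} τ-inj incident with π , π≗τ ← injective⇒permutation τ-inj =
    flip π , chosen , λ x → trans (cong (π ⟨$⟩ˡ_) (sym (π≗τ x))) (inverseˡ π)
    where
    chosen : Solution (flip π)
    chosen e = subst (Incident (π ⟨$⟩ˡ e)) (trans (sym (π≗τ (π ⟨$⟩ˡ e))) (inverseʳ π))
                     (incident (π ⟨$⟩ˡ e))

  Disagree : Permutation′ n → Permutation′ n → Fin n → Set
  Disagree σ π e = σ ⟨$⟩ʳ e ≢ π ⟨$⟩ʳ e

  module Orientation (connected : IsConnected) (σ : Permutation′ n) (σ-sol : Solution σ) where

    -- σ orients e towards σ e; mate e is the other endpoint, and parent x the tail of the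
    -- edge oriented into x.
    mate : Fin n → Fin n
    mate e with σ ⟨$⟩ʳ e ≟ a e
    ... | yes _ = b e
    ... | no  _ = a e

    incident⇒σ-or-mate : Incident x e → x ≡ σ ⟨$⟩ʳ e ⊎ x ≡ mate e
    incident⇒σ-or-mate {e = e} x-e with σ ⟨$⟩ʳ e ≟ a e | σ-sol e | x-e
    ... | yes σe≡a | _         | inj₁ x≡a = inj₁ (trans x≡a (sym σe≡a))
    ... | yes _    | _         | inj₂ x≡b = inj₂ x≡b
    ... | no  _    | _         | inj₁ x≡a = inj₂ x≡a
    ... | no  σe≢a | inj₁ σe≡a | inj₂ _   = contradiction σe≡a σe≢a
    ... | no  _    | inj₂ σe≡b | inj₂ x≡b = inj₁ (trans x≡b (sym σe≡b))

    disagree⇒mate : ∀ π → Solution π → Disagree σ π e → π ⟨$⟩ʳ e ≡ mate e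
    disagree⇒mate {e = e} π π-sol σe≢πe with incident⇒σ-or-mate (π-sol e)
    ... | inj₁ πe≡σe = contradiction (sym πe≡σe) σe≢πe
    ... | inj₂ πe≡mate = πe≡mate

    parent : Fin n → Fin n
    parent x = mate (σ ⟨$⟩ˡ x)

    parent-σ : ∀ e → parent (σ ⟨$⟩ʳ e) ≡ mate e
    parent-σ _ = cong mate (inverseˡ σ)

    Periodic : Fin n → Set
    Periodic x = ∃ λ p → (parent ^ suc p) x ≡ x

    Reaches : Fin n → Fin n → Set
    Reaches x y = ∃ λ k → (parent ^ k) x ≡ y

    module _ (π : Permutation′ n) (π-sol : Solution π) where

      φ : Fin n → Fin n
      φ e = σ ⟨$⟩ˡ (π ⟨$⟩ʳ e)

      φ-injective : Injective _≡_ _≡_ φ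
      φ-injective = ⟨$⟩ʳ-injective π ∘ ⟨$⟩ʳ-injective (flip σ)

      disagree-φ : Disagree σ π e → Disagree σ π (φ e)
      disagree-φ {e = e} σe≢πe σφe≡πφe = σe≢πe (trans (cong (σ ⟨$⟩ʳ_) e≡φe) σφe≡πe)
        where
        σφe≡πe : σ ⟨$⟩ʳ φ e ≡ π ⟨$⟩ʳ e
        σφe≡πe = inverseʳ σ
        e≡φe : e ≡ φ e
        e≡φe = ⟨$⟩ʳ-injective π (trans (sym σφe≡πe) σφe≡πφe)

      parent-along-disagreement : Disagree σ π e → parent (σ ⟨$⟩ʳ e) ≡ σ ⟨$⟩ʳ φ e
      parent-along-disagreement {e = e} σe≢πe = begin
        parent (σ ⟨$⟩ʳ e)  ≡⟨ parent-σ e ⟩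
        mate e             ≡⟨ disagree⇒mate π π-sol σe≢πe ⟨
        π ⟨$⟩ʳ e           ≡⟨ inverseʳ σ ⟨
        σ ⟨$⟩ʳ φ e         ∎
        where open ≡-Reasoning

      disagree-φ^ : Disagree σ π e → ∀ k → Disagree σ π ((φ ^ k) e)
      disagree-φ^ σe≢πe zero    = σe≢πe
      disagree-φ^ σe≢πe (suc k) = disagree-φ (disagree-φ^ σe≢πe k)

      parent^-along-disagreement : Disagree σ π e → ∀ k → (parent ^ k) (σ ⟨$⟩ʳ e) ≡ σ ⟨$⟩ʳ (φ ^ k) e
      parent^-along-disagreement σe≢πe zero    = refl
      parent^-along-disagreement σe≢πe (suc k) =
        trans (cong parent (parent^-along-disagreement σe≢πe k))
              (parent-along-disagreement (disagree-φ^ σe≢πe k))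

      disagreement-periodic : Disagree σ π e → Periodic (σ ⟨$⟩ʳ e)
      disagreement-periodic {e = e} σe≢πe with p , φᵖe≡e ← injective⇒periodic φ-injective e =
        p , trans (parent^-along-disagreement σe≢πe (suc p)) (cong (σ ⟨$⟩ʳ_) φᵖe≡e)

    periodic⇒reached : Periodic y → ∀ x → Reaches x y
    periodic⇒reached {y = y} (p , cycle) v = Star-preserves closed (connected y v) (0 , refl)
      where
      forward : Reaches x y → Reaches (parent x) y
      forward {x = x} (zero  , refl) = p , trans (^-commutes parent p x) cycle
      forward {x = x} (suc k , eq)   = k , trans (^-commutes parent k x) eq
      backward : Reaches (parent x) y → Reaches x y
      backward {x = x} (k , eq) = suc k , trans (sym (^-commutes parent k x)) eq
      closed : Adjacent x z → Reaches x y → Reaches z y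
      closed (e , x-e-z) with incident⇒σ-or-mate (joins⇒incident x-e-z)
                            | incident⇒σ-or-mate (joins⇒incident (joins-sym x-e-z))
      ... | inj₁ refl | inj₁ refl = id
      ... | inj₂ refl | inj₂ refl = id
      ... | inj₁ refl | inj₂ refl = subst (λ v → Reaches v y) (parent-σ e) ∘ forward
      ... | inj₂ refl | inj₁ refl = backward ∘ subst (λ v → Reaches v y) (sym (parent-σ e))

    module _ (ρ : Permutation′ n) (ρ-sol : Solution ρ) where

      disagree-parent : Disagree σ ρ (σ ⟨$⟩ˡ x) → Disagree σ ρ (σ ⟨$⟩ˡ parent x)
      disagree-parent {x = x} σe≢ρe σe′≡ρe′ = σe≢ρe (begin
        σ ⟨$⟩ʳ (σ ⟨$⟩ˡ x)           ≡⟨ cong (σ ⟨$⟩ʳ_) e′≡e ⟨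
        σ ⟨$⟩ʳ (σ ⟨$⟩ˡ parent x)    ≡⟨ inverseʳ σ ⟩
        parent x                   ≡⟨ disagree⇒mate ρ ρ-sol σe≢ρe ⟨
        ρ ⟨$⟩ʳ (σ ⟨$⟩ˡ x)           ∎)
        where
        open ≡-Reasoning
        e′≡e : σ ⟨$⟩ˡ parent x ≡ σ ⟨$⟩ˡ x
        e′≡e = ⟨$⟩ʳ-injective ρ
                 (trans (sym σe′≡ρe′) (trans (inverseʳ σ) (sym (disagree⇒mate ρ ρ-sol σe≢ρe))))

      disagree-parent^ : ∀ k → Disagree σ ρ (σ ⟨$⟩ˡ x) → Disagree σ ρ (σ ⟨$⟩ˡ (parent ^ k) x)
      disagree-parent^ zero    = id
      disagree-parent^ (suc k) = disagree-parent ∘ disagree-parent^ k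

      disagree-⊆ : ∀ π → Solution π → Disagree σ ρ e₁ → Disagree σ π e₀ → Disagree σ ρ e₀
      disagree-⊆ {e₁ = e₁} {e₀ = e₀} π π-sol σe₁≢ρe₁ σe₀≢πe₀
        with k , reach ← periodic⇒reached (disagreement-periodic π π-sol σe₀≢πe₀) (σ ⟨$⟩ʳ e₁) =
        subst (Disagree σ ρ) (inverseˡ σ)
          (subst (Disagree σ ρ ∘ (σ ⟨$⟩ˡ_)) reach
            (disagree-parent^ k (subst (Disagree σ ρ) (sym (inverseˡ σ)) σe₁≢ρe₁)))

  at-most-two-solutions : IsConnected → ∀ σ τ → Solution σ → Solution τ → Disagree σ τ e →
                          ∀ ρ → Solution ρ → ρ ≈ σ ⊎ ρ ≈ τ
  at-most-two-solutions connected σ τ σ-sol τ-sol σ≉τ ρ ρ-sol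
    with all? (λ e → ρ ⟨$⟩ʳ e ≟ σ ⟨$⟩ʳ e)
  ... | yes ρ≈σ = inj₁ ρ≈σ
  ... | no  ρ≉σ with e₁ , ρe₁≢σe₁ ← ¬∀⟶∃¬ n _ (λ e → ρ ⟨$⟩ʳ e ≟ σ ⟨$⟩ʳ e) ρ≉σ = inj₂ ρ≈τ
    where
    open Orientation connected σ σ-sol
    ρ≈τ : ρ ≈ τ
    ρ≈τ e with σ ⟨$⟩ʳ e ≟ τ ⟨$⟩ʳ e | σ ⟨$⟩ʳ e ≟ ρ ⟨$⟩ʳ e
    ... | yes σe≡τe | yes σe≡ρe = trans (sym σe≡ρe) σe≡τe
    ... | yes σe≡τe | no  σe≢ρe = contradiction σe≡τe (disagree-⊆ τ τ-sol ρ ρ-sol σ≉τ σe≢ρe)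
    ... | no  σe≢τe | _         =
      trans (disagree⇒mate ρ ρ-sol (disagree-⊆ ρ ρ-sol τ τ-sol (ρe₁≢σe₁ ∘ sym) σe≢τe))
            (sym (disagree⇒mate τ τ-sol σe≢τe))

module Unicyclic {n : ℕ} (a b : Fin (suc n) → Fin (suc n)) (connected : Multigraph.IsConnected a b) where

  open Multigraph a b
  open Solutions a b

  -- G − e, with the remaining edges renumbered by punchIn e.
  module Without (e : Fin (suc n)) = Multigraph (a ∘ punchIn e) (b ∘ punchIn e)

  redundant-edge : ∃ λ e → Without.IsConnected e
  redundant-edge with k , t , T , spanning ← Spanning.spanning-tree Fin.zero connected =
    e* , λ x y → to-root x ◅◅ reverse (λ (e , x-e-y) → e , joins-sym x-e-y) (to-root y)
    where
    open Spanning Fin.zero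
    open import Data.Vec.Membership.DecPropositional (_≟_ {suc n}) using (_∈?_)
    unused : ∃ λ e → e ∉ edges t
    unused = ¬∀⟶∃¬ (suc n) _ (_∈? edges t) λ all-used →
      ℕ.n≮n (suc n) (ℕ.≤-trans (s≤s (covering⇒≤ (edges t) all-used)) (tree-size T))
    e* = proj₁ unused
    step : ∀ {e x y} → e ∈ edges t → Joins e x y →
           Star (Without.Adjacent e*) x Fin.zero → Star (Without.Adjacent e*) y Fin.zero
    step {e} {x} {y} e∈ x-e-y path =
      (punchOut e*≢e , subst (λ e → Joins e y x) (sym (punchIn-punchOut e*≢e)) (joins-sym x-e-y)) ◅ path
      where
      e*≢e : e* ≢ e
      e*≢e refl = proj₂ unused e∈
    to-root : ∀ x → Star (Without.Adjacent e*) x Fin.zero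
    to-root x = tree-preserves T step ε (spanning x)

  module _ (e* : Fin (suc n)) {x : Fin (suc n)} (x-e* : Incident x e*) where

    open Without.Spanning e* x

    module _ {k} {t : Vec Branch k} (T : Tree t) (spanning : ∀ y → y ∈ vertices t) where

      choice : Fin (suc n) → Fin (suc n)
      choice y with y ≟ x
      ... | yes _   = e*
      ... | no  y≢x = punchIn e* (proj₁ (branch-of (spanning y) y≢x))

      choice-root : choice x ≡ e*
      choice-root with x ≟ x
      ... | yes _   = refl
      ... | no  x≢x = contradiction refl x≢x

      choice-injective : Injective _≡_ _≡_ choice
      choice-injective {y} {z} eq with y ≟ x | z ≟ x
      ... | yes y≡x | yes z≡x = trans y≡x (sym z≡x)
      ... | yes _   | no  _   = contradiction (sym eq) (punchInᵢ≢i e* _)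
      ... | no  _   | yes _   = contradiction eq (punchInᵢ≢i e* _)
      ... | no  y≢x | no  z≢x with e , y∈ ← branch-of (spanning y) y≢x
                              with e′ , z∈ ← branch-of (spanning z) z≢x =
        branch-injective T y∈ (subst (λ e → (z , e) ∈ t) (sym (punchIn-injective e* e e′ eq)) z∈)

      choice-incident : ∀ y → Incident y (choice y)
      choice-incident y with y ≟ x
      ... | yes refl = x-e*
      ... | no  y≢x  = branch-incident T (proj₂ (branch-of (spanning y) y≢x))

    solution-towards : Without.IsConnected e* → ∃ λ σ → Solution σ × σ ⟨$⟩ʳ e* ≡ x
    solution-towards connected′
      with k , t , T , spanning ← spanning-tree connected′
      with σ , σ-sol , σ∘choice≗id ←
             injective-choice⇒solution (choice-injective T spanning) (choice-incident T spanning) =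
      σ , σ-sol , trans (cong (σ ⟨$⟩ʳ_) (sym (choice-root T spanning))) (σ∘choice≗id x)

  exactly-two-solutions : (∀ e → a e ≢ b e) →
    Σ (Permutation′ (suc n)) λ σ → Σ (Permutation′ (suc n)) λ τ →
      Solution σ × Solution τ × (∃ λ e → Disagree σ τ e) × (∀ ρ → Solution ρ → ρ ≈ σ ⊎ ρ ≈ τ)
  exactly-two-solutions loopless =
    let e* , connected′    = redundant-edge
        σ , σ-sol , σe*≡a = solution-towards e* (inj₁ refl) connected′
        τ , τ-sol , τe*≡b = solution-towards e* (inj₂ refl) connected′
        σ≉τ : Disagree σ τ e*
        σ≉τ σe*≡τe* = loopless e* (trans (sym σe*≡a) (trans σe*≡τe* τe*≡b))
    in σ , τ , σ-sol , τ-sol , (e* , σ≉τ) , at-most-two-solutions connected σ τ σ-sol τ-sol σ≉τ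

countᵇ : (Fin n → Bool) → ℕ
countᵇ {zero}  c = 0
countᵇ {suc n} c = (if c Fin.zero then 1 else 0) + countᵇ (c ∘ Fin.suc)

sum-indicators : ∀ (c : Fin n → Bool) → sum (List.map (λ i → if c i then 1 else 0) (allFin n)) ≡ countᵇ c
sum-indicators {zero}  c = refl
sum-indicators {suc n} c = cong ((if c Fin.zero then 1 else 0) +_) (begin
  sum (List.map indicator (List.tabulate Fin.suc))    ≡⟨ cong sum (map-tabulate Fin.suc indicator) ⟩
  sum (List.tabulate (indicator ∘ Fin.suc))           ≡⟨ cong sum (map-tabulate id (indicator ∘ Fin.suc)) ⟨
  sum (List.map (indicator ∘ Fin.suc) (allFin n))     ≡⟨ sum-indicators (c ∘ Fin.suc) ⟩
  countᵇ (c ∘ Fin.suc)                                ∎)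
  where
  open ≡-Reasoning
  indicator : Fin (suc n) → ℕ
  indicator i = if c i then 1 else 0

countᵇ≤ : ∀ (c : Fin n → Bool) → countᵇ c ≤ n
countᵇ≤ {zero}  c = z≤n
countᵇ≤ {suc n} c with c Fin.zero
... | true  = s≤s (countᵇ≤ (c ∘ Fin.suc))
... | false = ℕ.m≤n⇒m≤1+n (countᵇ≤ (c ∘ Fin.suc))

count≡n⇒all : ∀ (c : Fin n → Bool) → countᵇ c ≡ n → ∀ i → T (c i)
count≡n⇒all {suc n} c count≡ i with c Fin.zero in c₀≡
count≡n⇒all {suc n} c count≡ Fin.zero    | true  = subst T (sym c₀≡) _
count≡n⇒all {suc n} c count≡ (Fin.suc i) | true  = count≡n⇒all (c ∘ Fin.suc) (ℕ.suc-injective count≡) i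
count≡n⇒all {suc n} c count≡ i           | false =
  contradiction (subst (_≤ n) count≡ (countᵇ≤ (c ∘ Fin.suc))) ℕ.1+n≰n

count≡0⇒none : ∀ (c : Fin n → Bool) → countᵇ c ≡ 0 → ∀ i → ¬ T (c i)
count≡0⇒none {suc n} c count≡ i with c Fin.zero in c₀≡
count≡0⇒none {suc n} c ()     i           | true
count≡0⇒none {suc n} c count≡ Fin.zero    | false = subst T c₀≡
count≡0⇒none {suc n} c count≡ (Fin.suc i) | false = count≡0⇒none (c ∘ Fin.suc) count≡ i

count≡1⇒one : ∀ (c : Fin n → Bool) → countᵇ c ≡ 1 → ∃ λ j → T (c j) × ∀ i → T (c i) → i ≡ j
count≡1⇒one {suc n} c count≡ with c Fin.zero in c₀≡
... | true  = Fin.zero , subst T (sym c₀≡) _ , λ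
  { Fin.zero    _   → refl
  ; (Fin.suc i) cᵢ → contradiction cᵢ (count≡0⇒none (c ∘ Fin.suc) (ℕ.suc-injective count≡) i) }
... | false with j , cⱼ , unique ← count≡1⇒one (c ∘ Fin.suc) count≡ = Fin.suc j , cⱼ , λ
  { Fin.zero    c₀ → contradiction (subst T c₀≡ c₀) λ ()
  ; (Fin.suc i) cᵢ → cong Fin.suc (unique i cᵢ) }

count≡2⇒two : ∀ (c : Fin n → Bool) → countᵇ c ≡ 2 →
              ∃₂ λ j k → j ≢ k × T (c j) × T (c k) × ∀ i → T (c i) → i ≡ j ⊎ i ≡ k
count≡2⇒two {suc n} c count≡ with c Fin.zero in c₀≡
... | true with k , cₖ , unique ← count≡1⇒one (c ∘ Fin.suc) (ℕ.suc-injective count≡) =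
  Fin.zero , Fin.suc k , (λ ()) , subst T (sym c₀≡) _ , cₖ , λ
  { Fin.zero    _  → inj₁ refl
  ; (Fin.suc i) cᵢ → inj₂ (cong Fin.suc (unique i cᵢ)) }
... | false with j , k , j≢k , cⱼ , cₖ , unique ← count≡2⇒two (c ∘ Fin.suc) count≡ =
  Fin.suc j , Fin.suc k , j≢k ∘ suc-injective , cⱼ , cₖ , λ
  { Fin.zero    c₀ → contradiction (subst T c₀≡ c₀) λ ()
  ; (Fin.suc i) cᵢ → Sum.map (cong Fin.suc) (cong Fin.suc) (unique i cᵢ) }

isCornerᵇ⇔IsCorner : ∀ p x → T (isCornerᵇ p x) ⇔ IsCorner p x
isCornerᵇ⇔IsCorner p x = mk⇔ found⇒corner corner⇒found
  where
  is-x : Fin 8 → Bool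
  is-x v = corner p v ≡ᵇ x
  found⇒corner : T (isCornerᵇ p x) → IsCorner p x
  found⇒corner found with v , corner≡ᵇx ← satisfied (any⁻ is-x (allFin 8) found) =
    v , ℕ.≡ᵇ⇒≡ (corner p v) x corner≡ᵇx
  corner⇒found : IsCorner p x → T (isCornerᵇ p x)
  corner⇒found (v , corner≡x) = any⁺ is-x (lose (∈-allFin v) (ℕ.≡⇒≡ᵇ (corner p v) x corner≡x))

every-cube-shares-two : ∀ W → numEdges W ≡ 8 → ∀ i → sharedCount (W i) ≡ 2
every-cube-shares-two W eight i =
  ℕ.≡ᵇ⇒≡ (sharedCount (W i)) 2 (count≡n⇒all edge (trans (sym (sum-indicators edge)) eight) i)
  where
  edge : Fin 8 → Bool
  edge j = sharedCount (W j) ≡ᵇ 2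

module CornerGraph (W : Family) (shares-two : ∀ i → sharedCount (W i) ≡ 2) where

  Shared : Fin 8 → Fin 8 → Set
  Shared i j = T (isCornerᵇ (W i) (baCorner j))

  shared-pair : ∀ i → ∃₂ λ j k → j ≢ k × Shared i j × Shared i k × ∀ l → Shared i l → l ≡ j ⊎ l ≡ k
  shared-pair i = count≡2⇒two shared (trans (sym (sum-indicators shared)) (shares-two i))
    where
    shared : Fin 8 → Bool
    shared j = isCornerᵇ (W i) (baCorner j)

  a b : Fin 8 → Fin 8
  a i = proj₁ (shared-pair i)
  b i = proj₁ (proj₂ (shared-pair i))

  open Multigraph a b
  open Solutions a b

  loopless : ∀ i → a i ≢ b i
  loopless i = let _ , _ , a≢b , _ = shared-pair i in a≢b

  corner⇒incident : ∀ i j → IsCorner (W i) (baCorner j) → Incident j i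
  corner⇒incident i j =
    let _ , _ , _ , _ , _ , only-a-b = shared-pair i
    in only-a-b j ∘ Equivalence.from (isCornerᵇ⇔IsCorner (W i) (baCorner j))

  incident⇒corner : ∀ i j → Incident j i → IsCorner (W i) (baCorner j)
  incident⇒corner i j (inj₁ refl) =
    let _ , _ , _ , a-shared , _ = shared-pair i
    in Equivalence.to (isCornerᵇ⇔IsCorner (W i) (baCorner (a i))) a-shared
  incident⇒corner i j (inj₂ refl) =
    let _ , _ , _ , _ , b-shared , _ = shared-pair i
    in Equivalence.to (isCornerᵇ⇔IsCorner (W i) (baCorner (b i))) b-shared

  G-connected : Connected W → Multigraph.IsConnected a b
  G-connected connected j k = map-Star adjacent (connected j k)
    where
    adjacent : ∀ {j k} → Adj W j k → Adjacent j k
    adjacent {j} {k} (i , _ , j≢k , cⱼ , cₖ) =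
      i , incident⇒joins (corner⇒incident i j cⱼ) (corner⇒incident i k cₖ) j≢k

  solution⇒IsSolution : ∀ σ → Solution σ → IsSolution W σ
  solution⇒IsSolution σ sol i = incident⇒corner i (σ ⟨$⟩ʳ i) (sol i)

  IsSolution⇒solution : ∀ σ → IsSolution W σ → Solution σ
  IsSolution⇒solution σ sol i = corner⇒incident i (σ ⟨$⟩ʳ i) (sol i)

  solution-number-is-two : Connected W → SolutionNumberIsTwo W
  solution-number-is-two connected =
    let σ , τ , σ-sol , τ-sol , disagreement , dichotomy =
          Unicyclic.exactly-two-solutions a b (G-connected connected) loopless
    in σ , τ , solution⇒IsSolution σ σ-sol , solution⇒IsSolution τ τ-sol , disagreement ,
       λ ρ ρ-sol → dichotomy ρ (IsSolution⇒solution ρ ρ-sol)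

lemma8 : (W : Family) → Distinct W → numEdges W ≡ 8 → Connected W
         → SolutionNumberIsTwo W
lemma8 W _ eight-edges = CornerGraph.solution-number-is-two W (every-cube-shares-two W eight-edges)
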